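{- Let $d\ge0$ be an integer and $K$ a group of order $2^{2d+1}$ having a central involution $g$, and suppose that $x_1,\dots,x_d,y_1,\dots,y_d\in K$ satisfy: (i) for each $i=1,\dots,d$, $T_i=1-x_i-y_i-x_iy_i\in\mathbb{Z}K$ is a perfect ternary array of modulus $2$ in $K$; (ii) $(1+g)\prod_{i=1}^d(1+x_i+y_i+x_iy_i)=\sum_{k\in K}k$ in $\mathbb{Z}K$. Let $G$ be a group containing $g$ as a central element and containing $K$ as a subgroup of index $2$. Then $G$ contains a Hadamard difference set.
   Context: For $A=\sum a_k k$ in a group ring, $A^{(-1)}=\sum a_k k^{ -1}$; functions are identified with group ring elements. A perfect ternary array of modulus $m$ in $K$ is a $\{+1,0,-1\}$-valued function $T$ on $K$ with $TT^{(-1)}=m^2$ in $\mathbb{Z}K$. A Hadamard difference set in a finite group $G$ is a subset $D$ whose $\{\pm1\}$-valued characteristic function ($-1$ on $D$, $+1$ off $D$) satisfies $DD^{(-1)}=|G|$ in $\mathbb{Z}G$. -}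

module Defs where

open import Data.Nat using (ℕ; zero; suc)
open import Data.Fin using (Fin; zero; suc)
open import Data.Integer using (ℤ; +_; -_; _+_; _-_; _*_; -1ℤ; 0ℤ; 1ℤ)
open import Data.Bool using (Bool; true; false; if_then_else_)
open import Data.Sum using (_⊎_)
open import Data.Product using (_×_)
open import Relation.Binary.PropositionalEquality using (_≡_; _≢_)
open import Relation.Nullary using (¬_; does)
open import Data.Fin using (_≟_)
open import Algebra.Structures using (IsGroup)
open import Function.Definitions using (Injective)

-- A finite group of order n, with carrier Fin n (every finite group is
-- isomorphic to one of this form) and propositional equality.
record FinGroup (n : ℕ) : Set where
  infixl 7 _∙_
  field
    _∙_    : Fin n → Fin n → Fin n
    ε      : Fin n
    _⁻¹    : Fin n → Fin n
    isGroup : IsGroup _≡_ _∙_ ε _⁻¹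

open FinGroup public

Central : ∀ {n} (G : FinGroup n) → Fin n → Set
Central G g = ∀ k → _∙_ G g k ≡ _∙_ G k g

CentralInvolution : ∀ {n} (G : FinGroup n) → Fin n → Set
CentralInvolution G g = Central G g × (_∙_ G g g ≡ ε G) × (g ≢ ε G)

-- Injective group homomorphism K → G (exhibits K as a subgroup of G)
record Embedding {m n : ℕ} (K : FinGroup m) (G : FinGroup n) : Set where
  field
    map       : Fin m → Fin n
    homo      : ∀ a b → map (_∙_ K a b) ≡ _∙_ G (map a) (map b)
    injective : Injective _≡_ _≡_ map

ΣFin : ∀ n → (Fin n → ℤ) → ℤ
ΣFin zero    f = 0ℤ
ΣFin (suc n) f = f zero + ΣFin n (λ i → f (suc i))

-- The integral group ring ZK: functions K → ℤ
ZG : ℕ → Set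
ZG n = Fin n → ℤ

module GroupRing {n : ℕ} (G : FinGroup n) where
  private
    _·_ = _∙_ G
    inv = _⁻¹ G

  δ : Fin n → ZG n
  δ k h = if does (h ≟ k) then 1ℤ else 0ℤ

  one : ZG n
  one = δ (ε G)

  const : ℤ → ZG n
  const m h = m * one h

  _⊕_ : ZG n → ZG n → ZG n
  (A ⊕ B) h = A h + B h

  _⊖_ : ZG n → ZG n → ZG n
  (A ⊖ B) h = A h - B h

  _⊛_ : ZG n → ZG n → ZG n
  (A ⊛ B) k = ΣFin n (λ h → A h * B (inv h · k))

  _⁽⁻¹⁾ : ZG n → ZG n
  (A ⁽⁻¹⁾) k = A (inv k)

  _≈_ : ZG n → ZG n → Set
  A ≈ B = ∀ k → A k ≡ B k

  total : ZG n
  total _ = 1ℤ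

  ∏ : ∀ d → (Fin d → ZG n) → ZG n
  ∏ zero    A = one
  ∏ (suc d) A = A zero ⊛ ∏ d (λ i → A (suc i))

  PerfectTernaryArray : ℕ → ZG n → Set
  PerfectTernaryArray m T =
    (∀ k → (T k ≡ 1ℤ) ⊎ (T k ≡ 0ℤ) ⊎ (T k ≡ -1ℤ))
    × ((T ⊛ (T ⁽⁻¹⁾)) ≈ const (+ (m Data.Nat.* m)))

  χ : (Fin n → Bool) → ZG n
  χ D k = if D k then -1ℤ else 1ℤ

  HadamardDifferenceSet : (Fin n → Bool) → Set
  HadamardDifferenceSet D = (χ D ⊛ (χ D ⁽⁻¹⁾)) ≈ const (+ n)

HasHadamardDifferenceSet : ∀ {n} → FinGroup n → Set
HasHadamardDifferenceSet {n} G =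
  Data.Product.Σ (Fin n → Bool) (GroupRing.HadamardDifferenceSet G)

-- Let T = ∏ Tᵢ and P = ∏ Pᵢ in ℤK. Each Tᵢ = 1 - xᵢ - yᵢ - xᵢyᵢ arises from Pᵢ = 1 + xᵢ + yᵢ + xᵢyᵢ
-- by negating part of its nonnegative mass, and such signings are closed under products, so T is a
-- signing of P; moreover T T⁽⁻¹⁾ = 4ᵈ. In G pick z outside K; as [G : K] = 2, the cosets K and zK
-- partition G, i.e. (1 + z) K = G. The element W = 1 - g + z + zg is a signing of (1 + z)(1 + g)
-- and, g being a central involution, W W⁽⁻¹⁾ = 4. Hence χ = W T is a signing of
-- (1 + z)(1 + g) P = (1 + z) K = G, so χ is ±1-valued, and χ χ⁽⁻¹⁾ = 4 · 4ᵈ = |G|: χ is the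
-- characteristic function of a Hadamard difference set.
module Submission where

open import Defs
open import Data.Nat as ℕ using (ℕ; zero; suc)
import Data.Nat.Properties as ℕP
open import Data.Fin using (Fin; zero; suc; _≟_)
open import Data.Fin.Properties using (any?; ¬∀⟶∃¬)
open import Data.Fin.Permutation using (permutation)
open import Data.Integer using (ℤ; +_; -1ℤ; 0ℤ; 1ℤ)
import Data.Integer.Properties as ℤP
open import Data.Integer.Tactic.RingSolver using (solve-∀)
open import Data.Nat.Tactic.RingSolver using () renaming (solve-∀ to ℕ-solve)
open import Data.Bool using (Bool; if_then_else_)
open import Data.Product using (∃-syntax; _×_; _,_; proj₁; proj₂)
open import Data.Sum using (_⊎_; inj₁; inj₂)
open import Function.Base using (_∘_; id)
open import Function.Bundles using (_⇔_; mk⇔; Equivalence)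
open import Relation.Binary.PropositionalEquality
open import Relation.Binary.Bundles using (Setoid)
import Relation.Binary.Reasoning.Setoid as SetoidReasoning
open import Relation.Nullary using (¬_; Dec; does; yes; no; contradiction)
open import Algebra.Bundles using (Group)
open import Algebra.Properties.Ring ℤP.+-*-ring using (x[y-z]≈xy-xz; [y-z]x≈yx-zx)
open import Algebra.Properties.Semiring.Sum ℤP.+-*-semiring
  using (sum; sum-syntax; sum-cong-≗; ∑-distrib-+; ∑-comm; ∑-permute;
         *-distribˡ-sum; *-distribʳ-sum; sum-replicate-zero)

module ℤSums where

  open import Data.Integer using (-_; _+_; _-_; _*_)

  -- GroupRing.δ G a unfolds to 𝟙 a for every group G, so what is proved here applies to it.
  𝟙 : ∀ {n} → Fin n → Fin n → ℤ
  𝟙 a h = if does (h ≟ a) then 1ℤ else 0ℤ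

  𝟙-cong-⇔ : ∀ {m n} {a h : Fin m} {b j : Fin n} → h ≡ a ⇔ j ≡ b → 𝟙 a h ≡ 𝟙 b j
  𝟙-cong-⇔ {a = a} {h} {b} {j} h≡a⇔j≡b with h ≟ a | j ≟ b
  ... | yes _   | yes _   = refl
  ... | no _    | no _    = refl
  ... | yes h≡a | no j≢b  = contradiction (Equivalence.to h≡a⇔j≡b h≡a) j≢b
  ... | no h≢a  | yes j≡b = contradiction (Equivalence.from h≡a⇔j≡b j≡b) h≢a

  𝟙-∘-inverse : ∀ {n} {σ τ : Fin n → Fin n} → (∀ x → τ (σ x) ≡ x) → (∀ y → σ (τ y) ≡ y) →
                ∀ a k → 𝟙 a (σ k) ≡ 𝟙 (τ a) k
  𝟙-∘-inverse {σ = σ} {τ} τσ στ a k =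
    𝟙-cong-⇔ (mk⇔ (λ σk≡a → trans (sym (τσ k)) (cong τ σk≡a)) (λ k≡τa → trans (cong σ k≡τa) (στ a)))

  𝟙-≢ : ∀ {n} {a h : Fin n} → h ≢ a → 𝟙 a h ≡ 0ℤ
  𝟙-≢ {a = a} {h} h≢a with h ≟ a
  ... | yes h≡a = contradiction h≡a h≢a
  ... | no _    = refl

  ΣFin≡sum : ∀ n (f : Fin n → ℤ) → ΣFin n f ≡ sum f
  ΣFin≡sum zero    f = refl
  ΣFin≡sum (suc n) f = cong (_+_ (f zero)) (ΣFin≡sum n (f ∘ suc))

  sum-𝟙 : ∀ {n} (a : Fin n) (f : Fin n → ℤ) → ∑[ h < n ] (𝟙 a h * f h) ≡ f a
  sum-𝟙 {suc n} zero f = begin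
    1ℤ * f zero + ∑[ h < n ] (0ℤ * f (suc h))
      ≡⟨ cong₂ _+_ (ℤP.*-identityˡ (f zero)) (sum-cong-≗ (ℤP.*-zeroˡ ∘ f ∘ suc)) ⟩
    f zero + ∑[ h < n ] 0ℤ
      ≡⟨ cong (_+_ (f zero)) (sum-replicate-zero n) ⟩
    f zero + 0ℤ
      ≡⟨ ℤP.+-identityʳ (f zero) ⟩
    f zero ∎
    where open ≡-Reasoning
  sum-𝟙 {suc n} (suc a) f = trans (ℤP.+-identityˡ _) (sum-𝟙 a (f ∘ suc))

  sum-reindex : ∀ {n} {σ τ : Fin n → Fin n} → (∀ x → τ (σ x) ≡ x) → (∀ y → σ (τ y) ≡ y) →
                ∀ f → ∑[ i < n ] f (σ i) ≡ sum f
  sum-reindex {σ = σ} {τ} τσ στ f = sym (∑-permute f (permutation σ τ στ τσ))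

  sum-1 : ∀ n → ∑[ i < n ] 1ℤ ≡ + n
  sum-1 zero    = refl
  sum-1 (suc n) = cong (_+_ 1ℤ) (sum-1 n)

  ∑-distrib-- : ∀ {n} (f g : Fin n → ℤ) → ∑[ i < n ] (f i - g i) ≡ sum f - sum g
  ∑-distrib-- f g = begin
    sum (λ i → f i + - g i)   ≡⟨ ∑-distrib-+ f (-_ ∘ g) ⟩
    sum f + sum (-_ ∘ g)      ≡⟨ cong (_+_ (sum f)) (sum-cong-≗ (sym ∘ ℤP.-1*i≡-i ∘ g)) ⟩
    sum f + sum (_*_ -1ℤ ∘ g) ≡⟨ cong (_+_ (sum f)) (sym (*-distribˡ-sum -1ℤ g)) ⟩
    sum f + -1ℤ * sum g       ≡⟨ cong (_+_ (sum f)) (ℤP.-1*i≡-i (sum g)) ⟩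
    sum f - sum g             ∎
    where open ≡-Reasoning

  NonNeg : ℤ → Set
  NonNeg x = ∃[ a ] x ≡ + a

  nonNeg-+ : ∀ {x y} → NonNeg x → NonNeg y → NonNeg (x + y)
  nonNeg-+ (a , refl) (b , refl) = a ℕ.+ b , refl

  nonNeg-* : ∀ {x y} → NonNeg x → NonNeg y → NonNeg (x * y)
  nonNeg-* (a , refl) (b , refl) = a ℕ.* b , sym (ℤP.pos-* a b)

  nonNeg-𝟙 : ∀ {n} (a h : Fin n) → NonNeg (𝟙 a h)
  nonNeg-𝟙 a h with h ≟ a
  ... | yes _ = 1 , refl
  ... | no _  = 0 , refl

  nonNeg-sum : ∀ {n} {f : Fin n → ℤ} → (∀ i → NonNeg (f i)) → NonNeg (sum f)
  nonNeg-sum {zero}  f≥0 = 0 , refl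
  nonNeg-sum {suc n} f≥0 = nonNeg-+ (f≥0 zero) (nonNeg-sum (f≥0 ∘ suc))

  nonNeg-+≡0 : ∀ {x y} → NonNeg x → NonNeg y → x + y ≡ 0ℤ → x ≡ 0ℤ × y ≡ 0ℤ
  nonNeg-+≡0 (a , refl) (b , refl) x+y≡0 =
    cong +_ (ℕP.m+n≡0⇒m≡0 a a+b≡0) , cong +_ (ℕP.m+n≡0⇒n≡0 a a+b≡0)
    where
    a+b≡0 : a ℕ.+ b ≡ 0
    a+b≡0 = ℤP.+-injective x+y≡0

  nonNeg-sum≡0 : ∀ {n} {f : Fin n → ℤ} → (∀ i → NonNeg (f i)) → sum f ≡ 0ℤ → ∀ i → f i ≡ 0ℤ
  nonNeg-sum≡0 {suc n} f≥0 Σf≡0 zero    = proj₁ (nonNeg-+≡0 (f≥0 zero) (nonNeg-sum (f≥0 ∘ suc)) Σf≡0)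
  nonNeg-sum≡0 {suc n} f≥0 Σf≡0 (suc i) =
    nonNeg-sum≡0 (f≥0 ∘ suc) (proj₂ (nonNeg-+≡0 (f≥0 zero) (nonNeg-sum (f≥0 ∘ suc)) Σf≡0)) i

  nonNeg-+≡1 : ∀ {x y} → NonNeg x → NonNeg y → x + y ≡ 1ℤ → x - y ≡ 1ℤ ⊎ x - y ≡ -1ℤ
  nonNeg-+≡1 (a , refl) (b , refl) x+y≡1 = cases a b (ℤP.+-injective x+y≡1)
    where
    cases : ∀ a b → a ℕ.+ b ≡ 1 → + a - + b ≡ 1ℤ ⊎ + a - + b ≡ -1ℤ
    cases 0 1 _ = inj₂ refl
    cases 1 0 _ = inj₁ refl


module GroupRingProperties {n : ℕ} (G : FinGroup n) where

  open import Data.Integer using (_+_; _-_; _*_)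
  open ℤSums

  open GroupRing G public

  asGroup : Group _ _
  asGroup = record { isGroup = isGroup G }

  open Group asGroup public
    using (assoc; identityˡ; identityʳ; inverseˡ; inverseʳ) renaming (_∙_ to _·_; ε to e; _⁻¹ to inv)
  open import Algebra.Properties.Group asGroup public
    using (⁻¹-involutive; ⁻¹-anti-homo-∙; identityʳ-unique; inverseʳ-unique; ε⁻¹≈ε;
           \\-leftDividesˡ; \\-leftDividesʳ; //-rightDividesˡ; //-rightDividesʳ)

  𝟙-translateˡ : ∀ b a k → 𝟙 a (inv b · k) ≡ 𝟙 (b · a) k
  𝟙-translateˡ b = 𝟙-∘-inverse (\\-leftDividesˡ b) (\\-leftDividesʳ b)

  𝟙-translateʳ : ∀ b a k → 𝟙 a (k · b) ≡ 𝟙 (a · inv b) k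
  𝟙-translateʳ b = 𝟙-∘-inverse (//-rightDividesʳ b) (//-rightDividesˡ b)

  𝟙-inv : ∀ a k → 𝟙 a (inv k) ≡ 𝟙 (inv a) k
  𝟙-inv = 𝟙-∘-inverse ⁻¹-involutive ⁻¹-involutive

  ⊛-sum : ∀ A B k → (A ⊛ B) k ≡ ∑[ h < n ] (A h * B (inv h · k))
  ⊛-sum A B k = ΣFin≡sum n _

  ⊛-cong : ∀ {A A′ B B′} → A ≈ A′ → B ≈ B′ → (A ⊛ B) ≈ (A′ ⊛ B′)
  ⊛-cong {A} {A′} {B} {B′} A≈A′ B≈B′ k = begin
    (A ⊛ B) k                           ≡⟨ ⊛-sum A B k ⟩
    ∑[ h < n ] (A h * B (inv h · k))    ≡⟨ sum-cong-≗ (λ h → cong₂ _*_ (A≈A′ h) (B≈B′ (inv h · k))) ⟩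
    ∑[ h < n ] (A′ h * B′ (inv h · k))  ≡⟨ ⊛-sum A′ B′ k ⟨
    (A′ ⊛ B′) k                         ∎
    where open ≡-Reasoning

  ⊛-congˡ : ∀ {A A′} B → A ≈ A′ → (A ⊛ B) ≈ (A′ ⊛ B)
  ⊛-congˡ B A≈A′ = ⊛-cong {B = B} {B} A≈A′ (λ _ → refl)

  ⊛-congʳ : ∀ A {B B′} → B ≈ B′ → (A ⊛ B) ≈ (A ⊛ B′)
  ⊛-congʳ A B≈B′ = ⊛-cong {A} {A} (λ _ → refl) B≈B′

  ⁽⁻¹⁾-cong : ∀ {A B} → A ≈ B → (A ⁽⁻¹⁾) ≈ (B ⁽⁻¹⁾)
  ⁽⁻¹⁾-cong A≈B = A≈B ∘ inv

  δ-⊛ : ∀ a B k → (δ a ⊛ B) k ≡ B (inv a · k)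
  δ-⊛ a B k = trans (⊛-sum (δ a) B k) (sum-𝟙 a (λ h → B (inv h · k)))

  one-⊛ : ∀ A → (one ⊛ A) ≈ A
  one-⊛ A k = trans (δ-⊛ e A k) (cong A (trans (cong (_· k) ε⁻¹≈ε) (identityˡ k)))

  one⁽⁻¹⁾ : (one ⁽⁻¹⁾) ≈ one
  one⁽⁻¹⁾ k = trans (𝟙-inv e k) (cong (λ a → 𝟙 a k) ε⁻¹≈ε)

  ⊛-distribʳ-⊕ : ∀ A B C → ((A ⊕ B) ⊛ C) ≈ ((A ⊛ C) ⊕ (B ⊛ C))
  ⊛-distribʳ-⊕ A B C k = begin
    ((A ⊕ B) ⊛ C) k
      ≡⟨ ⊛-sum (A ⊕ B) C k ⟩
    ∑[ h < n ] ((A h + B h) * C (inv h · k))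
      ≡⟨ sum-cong-≗ (λ h → ℤP.*-distribʳ-+ (C (inv h · k)) (A h) (B h)) ⟩
    ∑[ h < n ] (A h * C (inv h · k) + B h * C (inv h · k))
      ≡⟨ ∑-distrib-+ (λ h → A h * C (inv h · k)) (λ h → B h * C (inv h · k)) ⟩
    ∑[ h < n ] (A h * C (inv h · k)) + ∑[ h < n ] (B h * C (inv h · k))
      ≡⟨ cong₂ _+_ (⊛-sum A C k) (⊛-sum B C k) ⟨
    (A ⊛ C) k + (B ⊛ C) k ∎
    where open ≡-Reasoning

  ⊛-distribʳ-⊖ : ∀ A B C → ((A ⊖ B) ⊛ C) ≈ ((A ⊛ C) ⊖ (B ⊛ C))
  ⊛-distribʳ-⊖ A B C k = begin
    ((A ⊖ B) ⊛ C) k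
      ≡⟨ ⊛-sum (A ⊖ B) C k ⟩
    ∑[ h < n ] ((A h - B h) * C (inv h · k))
      ≡⟨ sum-cong-≗ (λ h → [y-z]x≈yx-zx (C (inv h · k)) (A h) (B h)) ⟩
    ∑[ h < n ] (A h * C (inv h · k) - B h * C (inv h · k))
      ≡⟨ ∑-distrib-- (λ h → A h * C (inv h · k)) (λ h → B h * C (inv h · k)) ⟩
    ∑[ h < n ] (A h * C (inv h · k)) - ∑[ h < n ] (B h * C (inv h · k))
      ≡⟨ cong₂ _-_ (⊛-sum A C k) (⊛-sum B C k) ⟨
    (A ⊛ C) k - (B ⊛ C) k ∎
    where open ≡-Reasoning

  ⊛-distribˡ-⊕ : ∀ A B C → (A ⊛ (B ⊕ C)) ≈ ((A ⊛ B) ⊕ (A ⊛ C))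
  ⊛-distribˡ-⊕ A B C k = begin
    (A ⊛ (B ⊕ C)) k
      ≡⟨ ⊛-sum A (B ⊕ C) k ⟩
    ∑[ h < n ] (A h * (B (inv h · k) + C (inv h · k)))
      ≡⟨ sum-cong-≗ (λ h → ℤP.*-distribˡ-+ (A h) (B (inv h · k)) (C (inv h · k))) ⟩
    ∑[ h < n ] (A h * B (inv h · k) + A h * C (inv h · k))
      ≡⟨ ∑-distrib-+ (λ h → A h * B (inv h · k)) (λ h → A h * C (inv h · k)) ⟩
    ∑[ h < n ] (A h * B (inv h · k)) + ∑[ h < n ] (A h * C (inv h · k))
      ≡⟨ cong₂ _+_ (⊛-sum A B k) (⊛-sum A C k) ⟨
    (A ⊛ B) k + (A ⊛ C) k ∎
    where open ≡-Reasoning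

  ⊛-distribˡ-⊖ : ∀ A B C → (A ⊛ (B ⊖ C)) ≈ ((A ⊛ B) ⊖ (A ⊛ C))
  ⊛-distribˡ-⊖ A B C k = begin
    (A ⊛ (B ⊖ C)) k
      ≡⟨ ⊛-sum A (B ⊖ C) k ⟩
    ∑[ h < n ] (A h * (B (inv h · k) - C (inv h · k)))
      ≡⟨ sum-cong-≗ (λ h → x[y-z]≈xy-xz (A h) (B (inv h · k)) (C (inv h · k))) ⟩
    ∑[ h < n ] (A h * B (inv h · k) - A h * C (inv h · k))
      ≡⟨ ∑-distrib-- (λ h → A h * B (inv h · k)) (λ h → A h * C (inv h · k)) ⟩
    ∑[ h < n ] (A h * B (inv h · k)) - ∑[ h < n ] (A h * C (inv h · k))
      ≡⟨ cong₂ _-_ (⊛-sum A B k) (⊛-sum A C k) ⟨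
    (A ⊛ B) k - (A ⊛ C) k ∎
    where open ≡-Reasoning

  scale : ℤ → ZG n → ZG n
  scale c A k = c * A k

  scale-⊛ : ∀ c A B → (scale c A ⊛ B) ≈ scale c (A ⊛ B)
  scale-⊛ c A B k = begin
    (scale c A ⊛ B) k                        ≡⟨ ⊛-sum (scale c A) B k ⟩
    ∑[ h < n ] (c * A h * B (inv h · k))     ≡⟨ sum-cong-≗ (λ h → ℤP.*-assoc c (A h) _) ⟩
    ∑[ h < n ] (c * (A h * B (inv h · k)))   ≡⟨ *-distribˡ-sum c (λ h → A h * B (inv h · k)) ⟨
    c * ∑[ h < n ] (A h * B (inv h · k))     ≡⟨ cong (c *_) (⊛-sum A B k) ⟨
    c * (A ⊛ B) k                            ∎
    where open ≡-Reasoning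

  𝟙-e-quotient : ∀ h k → 𝟙 e (inv h · k) ≡ 𝟙 k h
  𝟙-e-quotient h k = 𝟙-cong-⇔ (mk⇔
    (λ h⁻¹k≡e → sym (trans (inverseʳ-unique (inv h) k h⁻¹k≡e) (⁻¹-involutive h)))
    (λ { refl → inverseˡ h }))

  ⊛-const : ∀ c A → (A ⊛ const c) ≈ scale c A
  ⊛-const c A k = begin
    (A ⊛ const c) k                           ≡⟨ ⊛-sum A (const c) k ⟩
    ∑[ h < n ] (A h * (c * 𝟙 e (inv h · k)))  ≡⟨ sum-cong-≗ sift-form ⟩
    ∑[ h < n ] (𝟙 k h * (c * A h))            ≡⟨ sum-𝟙 k (λ h → c * A h) ⟩
    c * A k                                   ∎
    where
    open ≡-Reasoning
    swap : ∀ a c d → a * (c * d) ≡ d * (c * a)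
    swap = solve-∀
    sift-form : ∀ h → A h * (c * 𝟙 e (inv h · k)) ≡ 𝟙 k h * (c * A h)
    sift-form h = trans (cong (λ x → A h * (c * x)) (𝟙-e-quotient h k)) (swap (A h) c (𝟙 k h))

  ⊛-assoc : ∀ A B C → ((A ⊛ B) ⊛ C) ≈ (A ⊛ (B ⊛ C))
  ⊛-assoc A B C k = begin
    ((A ⊛ B) ⊛ C) k
      ≡⟨ ⊛-sum (A ⊛ B) C k ⟩
    ∑[ h < n ] ((A ⊛ B) h * C (inv h · k))
      ≡⟨ sum-cong-≗ (λ h → cong (_* C (inv h · k)) (⊛-sum A B h)) ⟩
    ∑[ h < n ] (∑[ j < n ] (A j * B (inv j · h)) * C (inv h · k))
      ≡⟨ sum-cong-≗ (λ h → *-distribʳ-sum (C (inv h · k)) (λ j → A j * B (inv j · h))) ⟩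
    ∑[ h < n ] ∑[ j < n ] (A j * B (inv j · h) * C (inv h · k))
      ≡⟨ ∑-comm (λ h j → A j * B (inv j · h) * C (inv h · k)) ⟩
    ∑[ j < n ] ∑[ h < n ] (A j * B (inv j · h) * C (inv h · k))
      ≡⟨ sum-cong-≗ (λ j → sum-reindex (\\-leftDividesʳ j) (\\-leftDividesˡ j)
                             (λ h → A j * B (inv j · h) * C (inv h · k))) ⟨
    ∑[ j < n ] ∑[ l < n ] (A j * B (inv j · (j · l)) * C (inv (j · l) · k))
      ≡⟨ sum-cong-≗ (λ j → sum-cong-≗ (λ l → regroup j l)) ⟩
    ∑[ j < n ] ∑[ l < n ] (A j * (B l * C (inv l · (inv j · k))))
      ≡⟨ sum-cong-≗ (λ j → *-distribˡ-sum (A j) (λ l → B l * C (inv l · (inv j · k)))) ⟨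
    ∑[ j < n ] (A j * ∑[ l < n ] (B l * C (inv l · (inv j · k))))
      ≡⟨ sum-cong-≗ (λ j → cong (A j *_) (⊛-sum B C (inv j · k))) ⟨
    ∑[ j < n ] (A j * (B ⊛ C) (inv j · k))
      ≡⟨ ⊛-sum A (B ⊛ C) k ⟨
    (A ⊛ (B ⊛ C)) k ∎
    where
    open ≡-Reasoning
    regroup : ∀ j l → A j * B (inv j · (j · l)) * C (inv (j · l) · k)
                      ≡ A j * (B l * C (inv l · (inv j · k)))
    regroup j l = trans (ℤP.*-assoc (A j) _ _)
      (cong₂ (λ x y → A j * (B x * C y)) (\\-leftDividesʳ j l)
             (trans (cong (_· k) (⁻¹-anti-homo-∙ j l)) (assoc (inv l) (inv j) k)))

  ⁽⁻¹⁾-anti : ∀ A B → ((A ⊛ B) ⁽⁻¹⁾) ≈ ((B ⁽⁻¹⁾) ⊛ (A ⁽⁻¹⁾))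
  ⁽⁻¹⁾-anti A B k = begin
    ((A ⊛ B) ⁽⁻¹⁾) k
      ≡⟨ ⊛-sum A B (inv k) ⟩
    ∑[ u < n ] (A u * B (inv u · inv k))
      ≡⟨ sum-cong-≗ swapped ⟨
    ∑[ u < n ] (B (inv (k · u)) * A (inv (inv (k · u) · k)))
      ≡⟨ sum-reindex (\\-leftDividesʳ k) (\\-leftDividesˡ k) (λ h → B (inv h) * A (inv (inv h · k))) ⟩
    ∑[ h < n ] (B (inv h) * A (inv (inv h · k)))
      ≡⟨ ⊛-sum (B ⁽⁻¹⁾) (A ⁽⁻¹⁾) k ⟨
    ((B ⁽⁻¹⁾) ⊛ (A ⁽⁻¹⁾)) k ∎
    where
    open ≡-Reasoning
    swapped : ∀ u → B (inv (k · u)) * A (inv (inv (k · u) · k)) ≡ A u * B (inv u · inv k)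
    swapped u = trans (ℤP.*-comm (B (inv (k · u))) _) (cong₂ (λ x y → A x * B y)
      (trans (cong (λ x → inv (x · k)) (⁻¹-anti-homo-∙ k u))
             (trans (cong inv (//-rightDividesˡ k (inv u))) (⁻¹-involutive u)))
      (⁻¹-anti-homo-∙ k u))

  ≈-setoid : Setoid _ _
  ≈-setoid = Fin n →-setoid ℤ

  norm-⊛ : ∀ A B a b → (A ⊛ (A ⁽⁻¹⁾)) ≈ const (+ a) → (B ⊛ (B ⁽⁻¹⁾)) ≈ const (+ b) →
           ((A ⊛ B) ⊛ ((A ⊛ B) ⁽⁻¹⁾)) ≈ const (+ (a ℕ.* b))
  norm-⊛ A B a b normA normB = begin
    (A ⊛ B) ⊛ ((A ⊛ B) ⁽⁻¹⁾)         ≈⟨ ⊛-congʳ (A ⊛ B) (⁽⁻¹⁾-anti A B) ⟩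
    (A ⊛ B) ⊛ ((B ⁽⁻¹⁾) ⊛ (A ⁽⁻¹⁾))  ≈⟨ ⊛-assoc (A ⊛ B) (B ⁽⁻¹⁾) (A ⁽⁻¹⁾) ⟨
    ((A ⊛ B) ⊛ (B ⁽⁻¹⁾)) ⊛ (A ⁽⁻¹⁾)  ≈⟨ ⊛-congˡ (A ⁽⁻¹⁾) (⊛-assoc A B (B ⁽⁻¹⁾)) ⟩
    (A ⊛ (B ⊛ (B ⁽⁻¹⁾))) ⊛ (A ⁽⁻¹⁾)  ≈⟨ ⊛-congˡ (A ⁽⁻¹⁾) (⊛-congʳ A normB) ⟩
    (A ⊛ const (+ b)) ⊛ (A ⁽⁻¹⁾)     ≈⟨ ⊛-congˡ (A ⁽⁻¹⁾) (⊛-const (+ b) A) ⟩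
    scale (+ b) A ⊛ (A ⁽⁻¹⁾)         ≈⟨ scale-⊛ (+ b) A (A ⁽⁻¹⁾) ⟩
    scale (+ b) (A ⊛ (A ⁽⁻¹⁾))       ≈⟨ cong (+ b *_) ∘ normA ⟩
    scale (+ b) (const (+ a))        ≈⟨ scale-const ⟩
    const (+ (a ℕ.* b))              ∎
    where
    open SetoidReasoning ≈-setoid
    scale-const : scale (+ b) (const (+ a)) ≈ const (+ (a ℕ.* b))
    scale-const k = trans (sym (ℤP.*-assoc (+ b) (+ a) (one k)))
      (cong (_* one k) (trans (ℤP.*-comm (+ b) (+ a)) (sym (ℤP.pos-* a b))))

  norm-∏ : ∀ {c} d (F : Fin d → ZG n) → (∀ i → (F i ⊛ (F i ⁽⁻¹⁾)) ≈ const (+ c)) →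
           (∏ d F ⊛ (∏ d F ⁽⁻¹⁾)) ≈ const (+ (c ℕ.^ d))
  norm-∏ zero F _ k = trans (one-⊛ (one ⁽⁻¹⁾) k) (trans (one⁽⁻¹⁾ k) (sym (ℤP.*-identityˡ (one k))))
  norm-∏ {c} (suc d) F normF =
    norm-⊛ (F zero) (∏ d (F ∘ suc)) c (c ℕ.^ d) (normF zero) (norm-∏ d (F ∘ suc) (normF ∘ suc))

  record Signing (X Y : ZG n) : Set where
    field
      pos neg    : ZG n
      pos-nonNeg : ∀ k → NonNeg (pos k)
      neg-nonNeg : ∀ k → NonNeg (neg k)
      X≈pos⊖neg  : X ≈ (pos ⊖ neg)
      Y≈pos⊕neg  : Y ≈ (pos ⊕ neg)

  nonNeg-⊛ : ∀ {A B} → (∀ k → NonNeg (A k)) → (∀ k → NonNeg (B k)) → ∀ k → NonNeg ((A ⊛ B) k)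
  nonNeg-⊛ {A} {B} A≥0 B≥0 k =
    subst NonNeg (sym (⊛-sum A B k)) (nonNeg-sum (λ h → nonNeg-* (A≥0 h) (B≥0 (inv h · k))))

  signing-refl : ∀ {A} → (∀ k → NonNeg (A k)) → Signing A A
  signing-refl {A} A≥0 = record
    { pos = A ; neg = λ _ → 0ℤ ; pos-nonNeg = A≥0 ; neg-nonNeg = λ _ → 0 , refl
    ; X≈pos⊖neg = λ k → sym (ℤP.+-identityʳ (A k)) ; Y≈pos⊕neg = λ k → sym (ℤP.+-identityʳ (A k)) }

  signing-⊛ : ∀ {X Y X′ Y′} → Signing X Y → Signing X′ Y′ → Signing (X ⊛ X′) (Y ⊛ Y′)
  signing-⊛ {X} {Y} {X′} {Y′} s s′ = record
    { pos = (P ⊛ P′) ⊕ (N ⊛ N′)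
    ; neg = (P ⊛ N′) ⊕ (N ⊛ P′)
    ; pos-nonNeg = λ k → nonNeg-+ (nonNeg-⊛ P≥0 P′≥0 k) (nonNeg-⊛ N≥0 N′≥0 k)
    ; neg-nonNeg = λ k → nonNeg-+ (nonNeg-⊛ P≥0 N′≥0 k) (nonNeg-⊛ N≥0 P′≥0 k)
    ; X≈pos⊖neg = λ k → begin
        (X ⊛ X′) k
          ≡⟨ ⊛-cong X≈ X′≈ k ⟩
        ((P ⊖ N) ⊛ (P′ ⊖ N′)) k
          ≡⟨ ⊛-distribʳ-⊖ P N (P′ ⊖ N′) k ⟩
        (P ⊛ (P′ ⊖ N′)) k - (N ⊛ (P′ ⊖ N′)) k
          ≡⟨ cong₂ _-_ (⊛-distribˡ-⊖ P P′ N′ k) (⊛-distribˡ-⊖ N P′ N′ k) ⟩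
        ((P ⊛ P′) k - (P ⊛ N′) k) - ((N ⊛ P′) k - (N ⊛ N′) k)
          ≡⟨ regroup-⊖ ((P ⊛ P′) k) ((P ⊛ N′) k) ((N ⊛ P′) k) ((N ⊛ N′) k) ⟩
        ((P ⊛ P′) k + (N ⊛ N′) k) - ((P ⊛ N′) k + (N ⊛ P′) k) ∎
    ; Y≈pos⊕neg = λ k → begin
        (Y ⊛ Y′) k
          ≡⟨ ⊛-cong Y≈ Y′≈ k ⟩
        ((P ⊕ N) ⊛ (P′ ⊕ N′)) k
          ≡⟨ ⊛-distribʳ-⊕ P N (P′ ⊕ N′) k ⟩
        (P ⊛ (P′ ⊕ N′)) k + (N ⊛ (P′ ⊕ N′)) k
          ≡⟨ cong₂ _+_ (⊛-distribˡ-⊕ P P′ N′ k) (⊛-distribˡ-⊕ N P′ N′ k) ⟩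
        ((P ⊛ P′) k + (P ⊛ N′) k) + ((N ⊛ P′) k + (N ⊛ N′) k)
          ≡⟨ regroup-⊕ ((P ⊛ P′) k) ((P ⊛ N′) k) ((N ⊛ P′) k) ((N ⊛ N′) k) ⟩
        ((P ⊛ P′) k + (N ⊛ N′) k) + ((P ⊛ N′) k + (N ⊛ P′) k) ∎
    }
    where
    open ≡-Reasoning
    open Signing s renaming (pos to P; neg to N; pos-nonNeg to P≥0; neg-nonNeg to N≥0;
                             X≈pos⊖neg to X≈; Y≈pos⊕neg to Y≈)
    open Signing s′ renaming (pos to P′; neg to N′; pos-nonNeg to P′≥0; neg-nonNeg to N′≥0;
                              X≈pos⊖neg to X′≈; Y≈pos⊕neg to Y′≈)
    regroup-⊖ : ∀ a b c d → (a - b) - (c - d) ≡ (a + d) - (b + c)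
    regroup-⊖ = solve-∀
    regroup-⊕ : ∀ a b c d → (a + b) + (c + d) ≡ (a + d) + (b + c)
    regroup-⊕ = solve-∀

  signing-∏ : ∀ d (F F′ : Fin d → ZG n) → (∀ i → Signing (F i) (F′ i)) → Signing (∏ d F) (∏ d F′)
  signing-∏ zero    F F′ _ = signing-refl (nonNeg-𝟙 e)
  signing-∏ (suc d) F F′ s = signing-⊛ (s zero) (signing-∏ d (F ∘ suc) (F′ ∘ suc) (s ∘ suc))

  signing-±1 : ∀ {X Y} → Signing X Y → Y ≈ total → ∀ k → X k ≡ 1ℤ ⊎ X k ≡ -1ℤ
  signing-±1 {X} {Y} s Y≈total k =
    subst (λ x → x ≡ 1ℤ ⊎ x ≡ -1ℤ) (sym (X≈pos⊖neg k))
      (nonNeg-+≡1 (pos-nonNeg k) (neg-nonNeg k) (trans (sym (Y≈pos⊕neg k)) (Y≈total k)))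
    where open Signing s

  hadamard-of-±1 : ∀ X → (∀ k → X k ≡ 1ℤ ⊎ X k ≡ -1ℤ) → (X ⊛ (X ⁽⁻¹⁾)) ≈ const (+ n) →
                   HasHadamardDifferenceSet G
  hadamard-of-±1 X X±1 normX = D , λ k → trans (⊛-cong χD≈X (⁽⁻¹⁾-cong χD≈X) k) (normX k)
    where
    D : Fin n → Bool
    D k = does (X k ℤP.≟ -1ℤ)
    sign-of : ∀ x → x ≡ 1ℤ ⊎ x ≡ -1ℤ → (if does (x ℤP.≟ -1ℤ) then -1ℤ else 1ℤ) ≡ x
    sign-of _ (inj₁ refl) = refl
    sign-of _ (inj₂ refl) = refl
    χD≈X : χ D ≈ X
    χD≈X k = sign-of (X k) (X±1 k)

  ternary-signing : ∀ x y → Signing (((one ⊖ δ x) ⊖ δ y) ⊖ δ (x · y)) (((one ⊕ δ x) ⊕ δ y) ⊕ δ (x · y))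
  ternary-signing x y = record
    { pos = one
    ; neg = (δ x ⊕ δ y) ⊕ δ (x · y)
    ; pos-nonNeg = nonNeg-𝟙 e
    ; neg-nonNeg = λ k → nonNeg-+ (nonNeg-+ (nonNeg-𝟙 x k) (nonNeg-𝟙 y k)) (nonNeg-𝟙 (x · y) k)
    ; X≈pos⊖neg = λ k → ⊖-assoc (one k) (δ x k) (δ y k) (δ (x · y) k)
    ; Y≈pos⊕neg = λ k → ⊕-assoc (one k) (δ x k) (δ y k) (δ (x · y) k)
    }
    where
    ⊖-assoc : ∀ a b c d → ((a - b) - c) - d ≡ a - ((b + c) + d)
    ⊖-assoc = solve-∀
    ⊕-assoc : ∀ a b c d → ((a + b) + c) + d ≡ a + ((b + c) + d)
    ⊕-assoc = solve-∀

  doubler : Fin n → Fin n → ZG n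
  doubler g z = ((one ⊖ δ g) ⊕ δ z) ⊕ δ (z · g)

  doubler-signing : ∀ g z → Signing (doubler g z) ((one ⊕ δ z) ⊛ (one ⊕ δ g))
  doubler-signing g z = record
    { pos = (one ⊕ δ z) ⊕ δ (z · g)
    ; neg = δ g
    ; pos-nonNeg = λ k → nonNeg-+ (nonNeg-+ (nonNeg-𝟙 e k) (nonNeg-𝟙 z k)) (nonNeg-𝟙 (z · g) k)
    ; neg-nonNeg = nonNeg-𝟙 g
    ; X≈pos⊖neg = λ k → move-⊖ (𝟙 e k) (𝟙 g k) (𝟙 z k) (𝟙 (z · g) k)
    ; Y≈pos⊕neg = λ k → begin
        ((one ⊕ δ z) ⊛ V) k
          ≡⟨ ⊛-distribʳ-⊕ one (δ z) V k ⟩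
        (one ⊛ V) k + (δ z ⊛ V) k
          ≡⟨ cong₂ _+_ (one-⊛ V k) (δ-⊛ z V k) ⟩
        V k + V (inv z · k)
          ≡⟨ cong (_+_ (V k)) (cong₂ _+_ (𝟙-translateˡ z e k) (𝟙-translateˡ z g k)) ⟩
        V k + (𝟙 (z · e) k + 𝟙 (z · g) k)
          ≡⟨ cong (λ a → V k + (𝟙 a k + 𝟙 (z · g) k)) (identityʳ z) ⟩
        V k + (𝟙 z k + 𝟙 (z · g) k)
          ≡⟨ move-⊕ (𝟙 e k) (𝟙 g k) (𝟙 z k) (𝟙 (z · g) k) ⟩
        ((𝟙 e k + 𝟙 z k) + 𝟙 (z · g) k) + 𝟙 g k ∎
    }
    where
    open ≡-Reasoning
    V = one ⊕ δ g
    move-⊖ : ∀ a b c d → ((a - b) + c) + d ≡ ((a + c) + d) - b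
    move-⊖ = solve-∀
    move-⊕ : ∀ a b c d → (a + b) + (c + d) ≡ ((a + c) + d) + b
    move-⊕ = solve-∀

  ⁽⁻¹⁾-at-quotient : ∀ A a k → (A ⁽⁻¹⁾) (inv a · k) ≡ A (inv k · a)
  ⁽⁻¹⁾-at-quotient A a k = cong A (trans (⁻¹-anti-homo-∙ (inv a) k) (cong (inv k ·_) (⁻¹-involutive a)))

  doubler-⊛ : ∀ g z B k →
              (doubler g z ⊛ B) k ≡ ((B k - B (inv g · k)) + B (inv z · k)) + B (inv (z · g) · k)
  doubler-⊛ g z B k = begin
    (doubler g z ⊛ B) k
      ≡⟨ ⊛-distribʳ-⊕ ((one ⊖ δ g) ⊕ δ z) (δ (z · g)) B k ⟩
    (((one ⊖ δ g) ⊕ δ z) ⊛ B) k + (δ (z · g) ⊛ B) k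
      ≡⟨ cong (_+ (δ (z · g) ⊛ B) k) (⊛-distribʳ-⊕ (one ⊖ δ g) (δ z) B k) ⟩
    (((one ⊖ δ g) ⊛ B) k + (δ z ⊛ B) k) + (δ (z · g) ⊛ B) k
      ≡⟨ cong (λ a → (a + (δ z ⊛ B) k) + (δ (z · g) ⊛ B) k) (⊛-distribʳ-⊖ one (δ g) B k) ⟩
    (((one ⊛ B) k - (δ g ⊛ B) k) + (δ z ⊛ B) k) + (δ (z · g) ⊛ B) k
      ≡⟨ cong₂ _+_ (cong₂ _+_ (cong₂ _-_ (one-⊛ B k) (δ-⊛ g B k)) (δ-⊛ z B k)) (δ-⊛ (z · g) B k) ⟩
    ((B k - B (inv g · k)) + B (inv z · k)) + B (inv (z · g) · k) ∎
    where open ≡-Reasoning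

  -- With j = k⁻¹ the value is (W j - W (j g)) + (W u + W (u g)) for u = j z. As g is an involution,
  -- W (x g) = δ_g x - δₑ x + δ_zg x + δ_z x, so the first pair is 2 (δₑ - δ_g) j and the second
  -- 2 (δ_z + δ_zg) u = 2 (δₑ + δ_g) j, using z g z⁻¹ = g.
  doubler-norm : ∀ {g} z → g · g ≡ e → Central G g → (doubler g z ⊛ (doubler g z ⁽⁻¹⁾)) ≈ const (+ 4)
  doubler-norm {g} z g·g≡e g-central k = begin
    (W ⊛ (W ⁽⁻¹⁾)) k
      ≡⟨ doubler-⊛ g z (W ⁽⁻¹⁾) k ⟩
    (((W ⁽⁻¹⁾) k - (W ⁽⁻¹⁾) (inv g · k)) + (W ⁽⁻¹⁾) (inv z · k)) + (W ⁽⁻¹⁾) (inv (z · g) · k)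
      ≡⟨ cong₂ _+_ (cong₂ _+_ (cong (_-_ (W j)) (⁽⁻¹⁾-at-quotient W g k)) (⁽⁻¹⁾-at-quotient W z k))
                   (trans (⁽⁻¹⁾-at-quotient W (z · g) k) (cong W (sym (assoc j z g)))) ⟩
    ((W j - W (j · g)) + W u) + W (u · g)
      ≡⟨ cong₂ (λ a b → ((W j - a) + W u) + b) (doubler-·g j) (doubler-·g u) ⟩
    ((W j - Wg j) + W u) + Wg u
      ≡⟨ collect (𝟙 e j) (𝟙 g j) (𝟙 z j) (𝟙 (z · g) j) (𝟙 e u) (𝟙 g u) (𝟙 z u) (𝟙 (z · g) u) ⟩
    + 2 * (𝟙 e j - 𝟙 g j) + + 2 * (𝟙 z u + 𝟙 (z · g) u)
      ≡⟨ cong₂ (λ a b → + 2 * (𝟙 e j - 𝟙 g j) + + 2 * (a + b))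
               (trans (𝟙-translateʳ z z j) (cong (λ a → 𝟙 a j) (inverseʳ z)))
               (trans (𝟙-translateʳ z (z · g) j) (cong (λ a → 𝟙 a j) zg/z≡g)) ⟩
    + 2 * (𝟙 e j - 𝟙 g j) + + 2 * (𝟙 e j + 𝟙 g j)
      ≡⟨ cancel (𝟙 e j) (𝟙 g j) ⟩
    + 4 * 𝟙 e j
      ≡⟨ cong (+ 4 *_) (trans (𝟙-inv e k) (cong (λ a → 𝟙 a k) ε⁻¹≈ε)) ⟩
    + 4 * one k ∎
    where
    open ≡-Reasoning
    W = doubler g z
    j = inv k
    u = j · z
    g⁻¹≡g : inv g ≡ g
    g⁻¹≡g = sym (inverseʳ-unique g g g·g≡e)
    Wg : Fin n → ℤ
    Wg x = ((𝟙 g x - 𝟙 e x) + 𝟙 (z · g) x) + 𝟙 z x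
    doubler-·g : ∀ x → W (x · g) ≡ Wg x
    doubler-·g x = cong₂ _+_ (cong₂ _+_ (cong₂ _-_
        (trans (𝟙-translateʳ g e x) (cong (λ a → 𝟙 a x) (trans (identityˡ (inv g)) g⁻¹≡g)))
        (trans (𝟙-translateʳ g g x) (cong (λ a → 𝟙 a x) (inverseʳ g))))
        (trans (𝟙-translateʳ g z x) (cong (λ a → 𝟙 (z · a) x) g⁻¹≡g)))
        (trans (𝟙-translateʳ g (z · g) x) (cong (λ a → 𝟙 a x) (//-rightDividesʳ g z)))
    zg/z≡g : (z · g) · inv z ≡ g
    zg/z≡g = trans (cong (_· inv z) (sym (g-central z))) (//-rightDividesʳ z g)
    collect : ∀ a b c d a′ b′ c′ d′ →
      ((((a - b) + c) + d) - (((b - a) + d) + c) + (((a′ - b′) + c′) + d′)) + (((b′ - a′) + d′) + c′)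
        ≡ + 2 * (a - b) + + 2 * (c′ + d′)
    collect = solve-∀
    cancel : ∀ a b → + 2 * (a - b) + + 2 * (a + b) ≡ + 4 * a
    cancel = solve-∀

m≢m+m : ∀ m → .{{_ : ℕ.NonZero m}} → m ≢ m ℕ.+ m
m≢m+m m = ℕP.<⇒≢ (ℕP.m<m+n m (ℕP.n≢0⇒n>0 (ℕ.≢-nonZero⁻¹ m)))

module Pushforward {m n : ℕ} {K : FinGroup m} {G : FinGroup n} (emb : Embedding K G) where

  open import Data.Integer using (_+_; _-_; _*_)
  open ℤSums

  module ℤK = GroupRingProperties K
  module ℤG = GroupRingProperties G
  open ℤG using (_·_; inv; _⊛_; _⊕_; _⊖_; _⁽⁻¹⁾; _≈_)
  open Embedding emb renaming (map to ι)

  ι-ε : ι ℤK.e ≡ ℤG.e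
  ι-ε = ℤG.identityʳ-unique (ι ℤK.e) (ι ℤK.e) (trans (sym (homo ℤK.e ℤK.e)) (cong ι (ℤK.identityˡ ℤK.e)))

  ι-inv : ∀ a → ι (ℤK.inv a) ≡ inv (ι a)
  ι-inv a = ℤG.inverseʳ-unique (ι a) (ι (ℤK.inv a))
    (trans (sym (homo a (ℤK.inv a))) (trans (cong ι (ℤK.inverseʳ a)) ι-ε))

  push : ZG m → ZG n
  push A w = ∑[ a < m ] (𝟙 (ι a) w * A a)

  push-cong : ∀ {A B} → A ℤK.≈ B → push A ≈ push B
  push-cong A≈B w = sum-cong-≗ (λ a → cong (𝟙 (ι a) w *_) (A≈B a))

  push-⊕ : ∀ A B → push (A ℤK.⊕ B) ≈ (push A ⊕ push B)
  push-⊕ A B w = trans (sum-cong-≗ (λ a → ℤP.*-distribˡ-+ (𝟙 (ι a) w) (A a) (B a)))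
                       (∑-distrib-+ (λ a → 𝟙 (ι a) w * A a) (λ a → 𝟙 (ι a) w * B a))

  push-⊖ : ∀ A B → push (A ℤK.⊖ B) ≈ (push A ⊖ push B)
  push-⊖ A B w = trans (sum-cong-≗ (λ a → x[y-z]≈xy-xz (𝟙 (ι a) w) (A a) (B a)))
                       (∑-distrib-- (λ a → 𝟙 (ι a) w * A a) (λ a → 𝟙 (ι a) w * B a))

  push-scale : ∀ c A → push (ℤK.scale c A) ≈ ℤG.scale c (push A)
  push-scale c A w = trans (sum-cong-≗ (λ a → swap (𝟙 (ι a) w) c (A a)))
                           (sym (*-distribˡ-sum c (λ a → 𝟙 (ι a) w * A a)))
    where
    swap : ∀ x c y → x * (c * y) ≡ c * (x * y)
    swap = solve-∀

  push-δ : ∀ a → push (ℤK.δ a) ≈ ℤG.δ (ι a)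
  push-δ a w = trans (sum-cong-≗ (λ b → ℤP.*-comm (𝟙 (ι b) w) (𝟙 a b))) (sum-𝟙 a (λ b → 𝟙 (ι b) w))

  push-const : ∀ c → push (ℤK.const c) ≈ ℤG.const c
  push-const c w = trans (push-scale c ℤK.one w)
    (cong (c *_) (trans (push-δ ℤK.e w) (cong (λ a → 𝟙 a w) ι-ε)))

  push-one⊕δ : ∀ a → push (ℤK.one ℤK.⊕ ℤK.δ a) ≈ (ℤG.one ⊕ ℤG.δ (ι a))
  push-one⊕δ a w = trans (push-⊕ ℤK.one (ℤK.δ a) w)
    (cong₂ _+_ (trans (push-δ ℤK.e w) (cong (λ b → 𝟙 b w) ι-ε)) (push-δ a w))

  push-⁽⁻¹⁾ : ∀ A → push (A ℤK.⁽⁻¹⁾) ≈ (push A ⁽⁻¹⁾)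
  push-⁽⁻¹⁾ A w = begin
    ∑[ a < m ] (𝟙 (ι a) w * A (ℤK.inv a))
      ≡⟨ sum-reindex ℤK.⁻¹-involutive ℤK.⁻¹-involutive (λ a → 𝟙 (ι a) w * A (ℤK.inv a)) ⟨
    ∑[ a < m ] (𝟙 (ι (ℤK.inv a)) w * A (ℤK.inv (ℤK.inv a)))
      ≡⟨ sum-cong-≗ (λ a → cong₂ _*_ (trans (cong (λ x → 𝟙 x w) (ι-inv a)) (sym (ℤG.𝟙-inv (ι a) w)))
                                      (cong A (ℤK.⁻¹-involutive a))) ⟩
    ∑[ a < m ] (𝟙 (ι a) (inv w) * A a) ∎
    where open ≡-Reasoning

  push-⊛ : ∀ A B → push (A ℤK.⊛ B) ≈ (push A ⊛ push B)
  push-⊛ A B w = trans lhs (sym rhs)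
    where
    open ≡-Reasoning
    swap : ∀ x y z → x * (y * z) ≡ y * (x * z)
    swap = solve-∀
    common = ∑[ b < m ] ∑[ c < m ] (A b * (𝟙 (ι (b ℤK.· c)) w * B c))
    lhs : push (A ℤK.⊛ B) w ≡ common
    lhs = begin
      ∑[ a < m ] (𝟙 (ι a) w * (A ℤK.⊛ B) a)
        ≡⟨ sum-cong-≗ (λ a → cong (𝟙 (ι a) w *_) (ℤK.⊛-sum A B a)) ⟩
      ∑[ a < m ] (𝟙 (ι a) w * ∑[ b < m ] (A b * B (ℤK.inv b ℤK.· a)))
        ≡⟨ sum-cong-≗ (λ a → *-distribˡ-sum (𝟙 (ι a) w) (λ b → A b * B (ℤK.inv b ℤK.· a))) ⟩
      ∑[ a < m ] ∑[ b < m ] (𝟙 (ι a) w * (A b * B (ℤK.inv b ℤK.· a)))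
        ≡⟨ ∑-comm (λ a b → 𝟙 (ι a) w * (A b * B (ℤK.inv b ℤK.· a))) ⟩
      ∑[ b < m ] ∑[ a < m ] (𝟙 (ι a) w * (A b * B (ℤK.inv b ℤK.· a)))
        ≡⟨ sum-cong-≗ (λ b → sum-reindex (ℤK.\\-leftDividesʳ b) (ℤK.\\-leftDividesˡ b)
                               (λ a → 𝟙 (ι a) w * (A b * B (ℤK.inv b ℤK.· a)))) ⟨
      ∑[ b < m ] ∑[ c < m ] (𝟙 (ι (b ℤK.· c)) w * (A b * B (ℤK.inv b ℤK.· (b ℤK.· c))))
        ≡⟨ sum-cong-≗ (λ b → sum-cong-≗ (λ c → trans
             (cong (λ x → 𝟙 (ι (b ℤK.· c)) w * (A b * B x)) (ℤK.\\-leftDividesʳ b c))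
             (swap (𝟙 (ι (b ℤK.· c)) w) (A b) (B c)))) ⟩
      common ∎
    rhs : (push A ⊛ push B) w ≡ common
    rhs = begin
      (push A ⊛ push B) w
        ≡⟨ ℤG.⊛-sum (push A) (push B) w ⟩
      ∑[ u < n ] (∑[ b < m ] (𝟙 (ι b) u * A b) * push B (inv u · w))
        ≡⟨ sum-cong-≗ (λ u → *-distribʳ-sum (push B (inv u · w)) (λ b → 𝟙 (ι b) u * A b)) ⟩
      ∑[ u < n ] ∑[ b < m ] (𝟙 (ι b) u * A b * push B (inv u · w))
        ≡⟨ ∑-comm (λ u b → 𝟙 (ι b) u * A b * push B (inv u · w)) ⟩
      ∑[ b < m ] ∑[ u < n ] (𝟙 (ι b) u * A b * push B (inv u · w))
        ≡⟨ sum-cong-≗ (λ b → trans (sum-cong-≗ (λ u → ℤP.*-assoc (𝟙 (ι b) u) (A b) _))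
                                    (sum-𝟙 (ι b) (λ u → A b * push B (inv u · w)))) ⟩
      ∑[ b < m ] (A b * ∑[ c < m ] (𝟙 (ι c) (inv (ι b) · w) * B c))
        ≡⟨ sum-cong-≗ (λ b → cong (A b *_) (sum-cong-≗ (λ c → cong (_* B c)
             (trans (ℤG.𝟙-translateˡ (ι b) (ι c) w) (cong (λ x → 𝟙 x w) (sym (homo b c))))))) ⟩
      ∑[ b < m ] (A b * ∑[ c < m ] (𝟙 (ι (b ℤK.· c)) w * B c))
        ≡⟨ sum-cong-≗ (λ b → *-distribˡ-sum (A b) (λ c → 𝟙 (ι (b ℤK.· c)) w * B c)) ⟩
      common ∎

  nonNeg-push : ∀ {A} → (∀ a → NonNeg (A a)) → ∀ w → NonNeg (push A w)
  nonNeg-push A≥0 w = nonNeg-sum (λ a → nonNeg-* (nonNeg-𝟙 (ι a) w) (A≥0 a))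

  signing-push : ∀ {X Y} → ℤK.Signing X Y → ℤG.Signing (push X) (push Y)
  signing-push s = record
    { pos = push pos
    ; neg = push neg
    ; pos-nonNeg = nonNeg-push pos-nonNeg
    ; neg-nonNeg = nonNeg-push neg-nonNeg
    ; X≈pos⊖neg = λ w → trans (push-cong X≈pos⊖neg w) (push-⊖ pos neg w)
    ; Y≈pos⊕neg = λ w → trans (push-cong Y≈pos⊕neg w) (push-⊕ pos neg w)
    }
    where open ℤK.Signing s

  norm-push : ∀ {A} c → (A ℤK.⊛ (A ℤK.⁽⁻¹⁾)) ℤK.≈ ℤK.const c → (push A ⊛ (push A ⁽⁻¹⁾)) ≈ ℤG.const c
  norm-push {A} c normA w = begin
    (push A ⊛ (push A ⁽⁻¹⁾)) w      ≡⟨ ℤG.⊛-congʳ (push A) (push-⁽⁻¹⁾ A) w ⟨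
    (push A ⊛ push (A ℤK.⁽⁻¹⁾)) w   ≡⟨ push-⊛ A (A ℤK.⁽⁻¹⁾) w ⟨
    push (A ℤK.⊛ (A ℤK.⁽⁻¹⁾)) w     ≡⟨ push-cong normA w ⟩
    push (ℤK.const c) w             ≡⟨ push-const c w ⟩
    ℤG.const c w                    ∎
    where open ≡-Reasoning

  image : ZG n
  image = push ℤK.total

  image-∈ : ∀ {w} → ∃[ a ] w ≡ ι a → image w ≡ 1ℤ
  image-∈ (a , refl) = trans (sum-cong-≗ ι-injective-𝟙) (sum-𝟙 a (λ _ → 1ℤ))
    where
    ι-injective-𝟙 : ∀ b → 𝟙 (ι b) (ι a) * 1ℤ ≡ 𝟙 a b * 1ℤ
    ι-injective-𝟙 b = cong (_* 1ℤ) (𝟙-cong-⇔ (mk⇔ (sym ∘ injective) (cong ι ∘ sym)))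

  image-outside : ∀ w → ¬ (∃[ a ] w ≡ ι a) → image w ≡ 0ℤ
  image-outside w w∉ι = trans (sum-cong-≗ (λ a → cong (_* 1ℤ) (𝟙-≢ (λ w≡ιa → w∉ι (a , w≡ιa)))))
                              (sum-replicate-zero m)

  sum-image : ∑[ w < n ] image w ≡ + m
  sum-image = begin
    ∑[ w < n ] ∑[ a < m ] (𝟙 (ι a) w * 1ℤ)   ≡⟨ ∑-comm (λ w a → 𝟙 (ι a) w * 1ℤ) ⟩
    ∑[ a < m ] ∑[ w < n ] (𝟙 (ι a) w * 1ℤ)   ≡⟨ sum-cong-≗ (λ a → sum-𝟙 (ι a) (λ _ → 1ℤ)) ⟩
    ∑[ a < m ] 1ℤ                           ≡⟨ sum-1 m ⟩
    + m                                     ∎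
    where open ≡-Reasoning

  ∈ι? : ∀ w → Dec (∃[ a ] w ≡ ι a)
  ∈ι? w = any? (λ a → w ≟ ι a)

  ∃-outside-image : m ≢ n → ∃[ z ] ¬ (∃[ a ] z ≡ ι a)
  ∃-outside-image m≢n = ¬∀⟶∃¬ n _ ∈ι? (λ ι-onto → m≢n (ℤP.+-injective (begin
    + m                 ≡⟨ sum-image ⟨
    ∑[ w < n ] image w  ≡⟨ sum-cong-≗ (λ w → image-∈ (ι-onto w)) ⟩
    ∑[ w < n ] 1ℤ       ≡⟨ sum-1 n ⟩
    + n                 ∎)))
    where open ≡-Reasoning

  -- image + image (z⁻¹ ·_) is at most 1 everywhere, as z ∉ K, and sums to m + m = n.
  cosets-cover : n ≡ m ℕ.+ m → ∀ {z} → ¬ (∃[ a ] z ≡ ι a) → ((ℤG.one ⊕ ℤG.δ z) ⊛ image) ≈ ℤG.total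
  cosets-cover n≡m+m {z} z∉ι w = begin
    ((ℤG.one ⊕ ℤG.δ z) ⊛ image) w
      ≡⟨ ℤG.⊛-distribʳ-⊕ ℤG.one (ℤG.δ z) image w ⟩
    (ℤG.one ⊛ image) w + (ℤG.δ z ⊛ image) w
      ≡⟨ cong₂ _+_ (ℤG.one-⊛ image w) (ℤG.δ-⊛ z image w) ⟩
    covered w
      ≡⟨ ℤP.i-j≡0⇒i≡j 1ℤ (covered w) (nonNeg-sum≡0 uncovered≥0 sum-uncovered w) ⟨
    1ℤ ∎
    where
    open ≡-Reasoning
    covered : Fin n → ℤ
    covered w = image w + image (inv z · w)
    z-from : ∀ {w a b} → w ≡ ι a → inv z · w ≡ ι b → z ≡ ι (a ℤK.· ℤK.inv b)
    z-from {w} {a} {b} w≡ιa z⁻¹w≡ιb = begin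
      z                       ≡⟨ ℤG.\\-leftDividesˡ w z ⟨
      w · (inv w · z)         ≡⟨ cong (w ·_) (trans (ℤG.⁻¹-anti-homo-∙ (inv z) w)
                                                    (cong (inv w ·_) (ℤG.⁻¹-involutive z))) ⟨
      w · inv (inv z · w)     ≡⟨ cong₂ (λ x y → x · inv y) w≡ιa z⁻¹w≡ιb ⟩
      ι a · inv (ι b)         ≡⟨ cong (ι a ·_) (ι-inv b) ⟨
      ι a · ι (ℤK.inv b)      ≡⟨ homo a (ℤK.inv b) ⟨
      ι (a ℤK.· ℤK.inv b)     ∎
    uncovered≥0 : ∀ w → NonNeg (1ℤ - covered w)
    1-[x+y] : ∀ {x y x′ y′} → x ≡ x′ → y ≡ y′ → NonNeg (1ℤ - (x′ + y′)) → NonNeg (1ℤ - (x + y))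
    1-[x+y] refl refl = id
    uncovered≥0 w with ∈ι? w | ∈ι? (inv z · w)
    ... | yes (a , p) | yes (b , q) = contradiction (_ , z-from p q) z∉ι
    ... | yes p | no  q = 1-[x+y] (image-∈ p) (image-outside _ q) (0 , refl)
    ... | no  p | yes q = 1-[x+y] (image-outside _ p) (image-∈ q) (0 , refl)
    ... | no  p | no  q = 1-[x+y] (image-outside _ p) (image-outside _ q) (1 , refl)
    sum-covered : sum covered ≡ + n
    sum-covered = begin
      sum covered
        ≡⟨ ∑-distrib-+ image (λ w → image (inv z · w)) ⟩
      sum image + ∑[ w < n ] image (inv z · w)
        ≡⟨ cong (_+_ (sum image))
                (sum-reindex {σ = inv z ·_} (ℤG.\\-leftDividesˡ z) (ℤG.\\-leftDividesʳ z) image) ⟩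
      sum image + sum image
        ≡⟨ cong₂ _+_ sum-image sum-image ⟩
      + (m ℕ.+ m)
        ≡⟨ cong +_ n≡m+m ⟨
      + n ∎
    sum-uncovered : ∑[ w < n ] (1ℤ - covered w) ≡ 0ℤ
    sum-uncovered = begin
      ∑[ w < n ] (1ℤ - covered w)      ≡⟨ ∑-distrib-- (λ _ → 1ℤ) covered ⟩
      ∑[ w < n ] 1ℤ - sum covered      ≡⟨ cong₂ _-_ (sum-1 n) sum-covered ⟩
      + n - + n                        ≡⟨ ℤP.+-inverseʳ (+ n) ⟩
      0ℤ                               ∎

  hadamard-lift : ∀ {T P} g c .{{_ : ℕ.NonZero m}} → n ≡ m ℕ.+ m → 4 ℕ.* c ≡ n →
                  g ℤK.· g ≡ ℤK.e → Central G (ι g) → ℤK.Signing T P →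
                  ((ℤK.one ℤK.⊕ ℤK.δ g) ℤK.⊛ P) ℤK.≈ ℤK.total → (T ℤK.⊛ (T ℤK.⁽⁻¹⁾)) ℤK.≈ ℤK.const (+ c) →
                  HasHadamardDifferenceSet G
  hadamard-lift {T} {P} g c n≡m+m 4c≡n g·g≡e ιg-central T-signs-P cover normT =
    ℤG.hadamard-of-±1 χ (ℤG.signing-±1 χ-signing χ-cover) χ-norm
    where
    open ℤG using (one; δ; total; const)
    z-missed : ∃[ z ] ¬ (∃[ a ] z ≡ ι a)
    z-missed = ∃-outside-image (λ m≡n → m≢m+m m (trans m≡n n≡m+m))
    z : Fin n
    z = proj₁ z-missed
    χ : ZG n
    χ = ℤG.doubler (ι g) z ⊛ push T
    χ-signing : ℤG.Signing χ (((one ⊕ δ z) ⊛ (one ⊕ δ (ι g))) ⊛ push P)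
    χ-signing = ℤG.signing-⊛ (ℤG.doubler-signing (ι g) z) (signing-push T-signs-P)
    χ-cover : (((one ⊕ δ z) ⊛ (one ⊕ δ (ι g))) ⊛ push P) ≈ total
    χ-cover = begin
      ((one ⊕ δ z) ⊛ (one ⊕ δ (ι g))) ⊛ push P
        ≈⟨ ℤG.⊛-assoc (one ⊕ δ z) (one ⊕ δ (ι g)) (push P) ⟩
      (one ⊕ δ z) ⊛ ((one ⊕ δ (ι g)) ⊛ push P)
        ≈⟨ ℤG.⊛-congʳ (one ⊕ δ z) (ℤG.⊛-congˡ (push P) (push-one⊕δ g)) ⟨
      (one ⊕ δ z) ⊛ (push (ℤK.one ℤK.⊕ ℤK.δ g) ⊛ push P)
        ≈⟨ ℤG.⊛-congʳ (one ⊕ δ z) (push-⊛ (ℤK.one ℤK.⊕ ℤK.δ g) P) ⟨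
      (one ⊕ δ z) ⊛ push ((ℤK.one ℤK.⊕ ℤK.δ g) ℤK.⊛ P)
        ≈⟨ ℤG.⊛-congʳ (one ⊕ δ z) (push-cong cover) ⟩
      (one ⊕ δ z) ⊛ image
        ≈⟨ cosets-cover n≡m+m (proj₂ z-missed) ⟩
      total ∎
      where open SetoidReasoning ℤG.≈-setoid
    ιg·ιg≡e : ι g · ι g ≡ ℤG.e
    ιg·ιg≡e = trans (sym (homo g g)) (trans (cong ι g·g≡e) ι-ε)
    χ-norm : (χ ⊛ (χ ⁽⁻¹⁾)) ≈ const (+ n)
    χ-norm w = trans
      (ℤG.norm-⊛ (ℤG.doubler (ι g) z) (push T) 4 c
         (ℤG.doubler-norm z ιg·ιg≡e ιg-central) (norm-push (+ c) normT) w)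
      (cong (λ t → const (+ t) w) 4c≡n)

open import Data.Nat using (_+_; _*_; _^_)

4*4^d≡2*2^[2d+1] : ∀ d → 4 * 4 ^ d ≡ 2 * 2 ^ (2 * d + 1)
4*4^d≡2*2^[2d+1] zero    = refl
4*4^d≡2*2^[2d+1] (suc d) = begin
  4 * (4 * 4 ^ d)            ≡⟨ cong (4 *_) (4*4^d≡2*2^[2d+1] d) ⟩
  4 * (2 * 2 ^ (2 * d + 1))  ≡⟨ regroup (2 ^ (2 * d + 1)) ⟩
  2 * 2 ^ (2 + (2 * d + 1))  ≡⟨ cong (λ t → 2 * 2 ^ t) (exponent d) ⟩
  2 * 2 ^ (2 * suc d + 1)    ∎
  where
  open ≡-Reasoning
  regroup : ∀ x → 4 * (2 * x) ≡ 2 * (2 * (2 * x))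
  regroup = ℕ-solve
  exponent : ∀ d → 2 + (2 * d + 1) ≡ 2 * suc d + 1
  exponent = ℕ-solve

corollary4p8 :
    (d : ℕ) (K : FinGroup (2 ^ (2 * d + 1))) (g : Fin (2 ^ (2 * d + 1))) →
    CentralInvolution K g →
    (x y : Fin d → Fin (2 ^ (2 * d + 1))) →
    (∀ i → GroupRing.PerfectTernaryArray K 2
             (GroupRing._⊖_ K (GroupRing._⊖_ K (GroupRing._⊖_ K (GroupRing.one K) (GroupRing.δ K (x i))) (GroupRing.δ K (y i))) (GroupRing.δ K (_∙_ K (x i) (y i))))) →
    GroupRing._≈_ K
      (GroupRing._⊛_ K (GroupRing._⊕_ K (GroupRing.one K) (GroupRing.δ K g))
        (GroupRing.∏ K d (λ i → GroupRing._⊕_ K (GroupRing._⊕_ K (GroupRing._⊕_ K (GroupRing.one K) (GroupRing.δ K (x i))) (GroupRing.δ K (y i))) (GroupRing.δ K (_∙_ K (x i) (y i))))))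
      (GroupRing.total K) →
    (G : FinGroup (2 * 2 ^ (2 * d + 1))) (ι : Embedding K G) →
    Central G (Embedding.map ι g) →
    HasHadamardDifferenceSet G
corollary4p8 d K g (_ , g·g≡e , _) x y ternary cover G emb g-central =
  hadamard-lift g (4 ^ d) {{ℕP.m^n≢0 2 (2 * d + 1)}} (cong (_+_ m) (ℕP.+-identityʳ m)) (4*4^d≡2*2^[2d+1] d)
    g·g≡e g-central (ℤK.signing-∏ d Tᵢ Pᵢ (λ i → ℤK.ternary-signing (x i) (y i))) cover
    (ℤK.norm-∏ d Tᵢ (proj₂ ∘ ternary))
  where
  open Pushforward emb
  m : ℕ
  m = 2 ^ (2 * d + 1)
  Tᵢ Pᵢ : Fin d → ZG m
  Tᵢ i = ((ℤK.one ℤK.⊖ ℤK.δ (x i)) ℤK.⊖ ℤK.δ (y i)) ℤK.⊖ ℤK.δ (x i ℤK.· y i)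
  Pᵢ i = ((ℤK.one ℤK.⊕ ℤK.δ (x i)) ℤK.⊕ ℤK.δ (y i)) ℤK.⊕ ℤK.δ (x i ℤK.· y i)
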